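{- Let $n\ge 0$ and let $i\ge j\ge 0$ be integers with $i+j\le n$ and $i+j\equiv n\pmod 2$. Let $$\mathcal{M}^{(2)}_{n,i;j}=\{(P,Q): P,Q \text{ paths of length } n,\ -P\le Q\le P,\ h(P)=i+j,\ h(Q)=i-j\},$$ $$\mathcal{P}^{(2)}_{n,i;j}=\{(P,Q): P,Q \text{ paths of length } n,\ 0\le Q\le P,\ i-j\le h(Q)\le i+j\le h(P)\}.$$ Then the map $\varphi:\mathcal{M}^{(2)}_{n,i;j}\to\mathcal{P}^{(2)}_{n,i;j}$ defined in the context is injective.
   Context: A path of length $n$ is a lattice path in $\mathbb{Z}^2$ starting at $(0,0)$ with $n$ steps, each $U=(1,1)$ or $D=(1,-1)$. $h_a(P)$ is the $y$-coordinate at $x=a$, $h(P)=h_n(P)$; $Q\le P$ means $h_a(Q)\le h_a(P)$ for all $a$; $0\le Q$ means $h_a(Q)\ge0$ for all $a$; $-P$ is the reflection of $P$ in the $x$-axis. Flipping a step means changing $U$ to $D$ or vice versa. The disagreement path $(P-Q)/2$ is the path with steps $U,D,H=(1,0)$ whose height at each $a$ is $(h_a(P)-h_a(Q))/2$. Matching: ignoring $H$ steps and reading left to right, regard $U$ as "(" and $D$ as ")", and match each $D$ with the nearest preceding not-yet-matched $U$, if any; the remaining $U$ and $D$ steps are unmatched. The map $\varphi$: given $(P,Q)$, let $Q'$ be obtained from $Q$ by flipping every step ending strictly below the $x$-axis; let $\chi$ be the set of positions of the unmatched $D$ steps of $(P-Q')/2$; let $\widetilde P,\widetilde Q$ be obtained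 from $P,Q'$ by flipping the steps in positions $\chi$; set $\varphi(P,Q)=(\widetilde P,\widetilde Q)$. (It is known that $\varphi$ maps $\mathcal{M}^{(2)}_{n,i;j}$ into $\mathcal{P}^{(2)}_{n,i;j}$.) -}

module Defs where

open import Data.Nat using (ℕ; zero; suc)
open import Data.Integer using (ℤ; +_; -_; _+_; _-_; _<?_)
import Data.Integer as ℤ
open import Data.Vec using (Vec; []; _∷_)
open import Data.Bool using (Bool; true; false; if_then_else_)
open import Data.Product using (_×_; _,_)
open import Relation.Nullary.Decidable using (⌊_⌋)
open import Relation.Binary.PropositionalEquality using (_≡_)

-- Steps U = (1,1), D = (1,-1)
data Step : Set where
  U D : Step

Path : ℕ → Set
Path n = Vec Step n

stepVal : Step → ℤ
stepVal U = + 1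
stepVal D = - (+ 1)

flipStep : Step → Step
flipStep U = D
flipStep D = U

-- h_a(P): height after the first a steps (meaningful for a ≤ n)
ht : ∀ {n} → Path n → ℕ → ℤ
ht p zero = + 0
ht [] (suc a) = + 0
ht (s ∷ p) (suc a) = stepVal s + ht p a

h : ∀ {n} → Path n → ℤ
h {n} p = ht p n

_≤P_ : ∀ {n} → Path n → Path n → Set
_≤P_ {n} q p = ∀ a → a Data.Nat.≤ n → ht q a ℤ.≤ ht p a

negBelow : ∀ {n} → Path n → Path n → Set
negBelow {n} p q = ∀ a → a Data.Nat.≤ n → - ht p a ℤ.≤ ht q a

nonneg : ∀ {n} → Path n → Set
nonneg {n} q = ∀ a → a Data.Nat.≤ n → + 0 ℤ.≤ ht q a

-- Q': flip every step of Q that ends strictly below the x-axis.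
-- The accumulator is the height of the original Q before the current step.
flipNegAux : ∀ {n} → ℤ → Path n → Path n
flipNegAux c [] = []
flipNegAux c (s ∷ q) =
  (if ⌊ c + stepVal s <? + 0 ⌋ then flipStep s else s) ∷ flipNegAux (c + stepVal s) q

flipNeg : ∀ {n} → Path n → Path n
flipNeg = flipNegAux (+ 0)

-- Steps of the disagreement path (P - Q)/2
data DStep : Set where
  DU DD DH : DStep

dstep : Step → Step → DStep
dstep U D = DU
dstep D U = DD
dstep U U = DH
dstep D D = DH

disagree : ∀ {n} → Path n → Path n → Vec DStep n
disagree [] [] = []
disagree (s ∷ p) (t ∷ q) = dstep s t ∷ disagree p q

-- Unmatched D steps: scanning left to right, the counter is the number of
-- not-yet-matched U steps; a D is matched with the nearest preceding
-- unmatched U if there is one (counter > 0), otherwise it is unmatched.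
unmatchedDAux : ∀ {n} → ℕ → Vec DStep n → Vec Bool n
unmatchedDAux c [] = []
unmatchedDAux c (DU ∷ w) = false ∷ unmatchedDAux (suc c) w
unmatchedDAux c (DH ∷ w) = false ∷ unmatchedDAux c w
unmatchedDAux zero (DD ∷ w) = true ∷ unmatchedDAux zero w
unmatchedDAux (suc c) (DD ∷ w) = false ∷ unmatchedDAux c w

unmatchedD : ∀ {n} → Vec DStep n → Vec Bool n
unmatchedD = unmatchedDAux zero

flipAt : ∀ {n} → Vec Bool n → Path n → Path n
flipAt [] [] = []
flipAt (b ∷ χ) (s ∷ p) = (if b then flipStep s else s) ∷ flipAt χ p

φ : ∀ {n} → Path n → Path n → Path n × Path n
φ p q =
  let q' = flipNeg q
      χ  = unmatchedD (disagree p q')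
  in flipAt χ p , flipAt χ q'

inM : (n i j : ℕ) → Path n → Path n → Set
inM n i j p q =
  negBelow p q × q ≤P p × h p ≡ + (i Data.Nat.+ j) × h q ≡ + i - + j

inP : (n i j : ℕ) → Path n → Path n → Set
inP n i j p q =
  nonneg q × q ≤P p × (+ i - + j) ℤ.≤ h q × h q ℤ.≤ + (i Data.Nat.+ j)
    × + (i Data.Nat.+ j) ℤ.≤ h p

-- Only h(P) and h(Q) matter. Each position of χ turns a D step of P into U, so
-- h(P̃) = h(P) + 2|χ| and |χ| is read off the image. On the disagreement path φ turns
-- each unmatched D into U; such a U could also be a genuine U, but reading it as an
-- unmatched D forces strictly more unmatched D steps afterwards, so knowing |χ|
-- resolves every ambiguity. Finally Q' determines Q once h(Q) is known.

module Submission where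

open import Defs
open import Data.Nat using (ℕ; _≤_; _+_; _%_)
open import Data.Product using (_×_; _,_)
open import Relation.Binary.PropositionalEquality using (_≡_)

open import Data.Nat using (zero; suc; _<_; s≤s; z≤n; z<s; pred; ⌊_/2⌋)
open import Data.Nat.Properties using (m≤n⇒m≤1+n; n≮n; n≡⌊n+n/2⌋)
open import Data.Integer using (ℤ; +_; -_; _<?_)
import Data.Integer as ℤ
import Data.Integer.Properties as ℤP
open import Data.Integer.Tactic.RingSolver using (solve-∀)
open import Algebra.Properties.AbelianGroup ℤP.+-0-abelianGroup using (∙-cancelˡ; ∙-cancelʳ)
open import Data.Vec using (Vec; []; _∷_; countᵇ)
open import Data.Vec.Properties using (∷-injectiveˡ; ∷-injectiveʳ)
open import Data.Bool using (Bool; true; false; if_then_else_)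
open import Data.Product using (proj₁; proj₂)
open import Data.Empty using (⊥-elim)
open import Function using (id)
open import Relation.Nullary.Decidable using (⌊_⌋)
open import Relation.Binary.PropositionalEquality
  using (_≢_; refl; sym; trans; cong; cong₂; subst; module ≡-Reasoning)

countTrue : ∀ {n} → Vec Bool n → ℕ
countTrue = countᵇ id

swapUnmatched : ∀ {n} → ℕ → Vec DStep n → Vec DStep n
swapUnmatched c []             = []
swapUnmatched c (DU ∷ w)       = DU ∷ swapUnmatched (suc c) w
swapUnmatched c (DH ∷ w)       = DH ∷ swapUnmatched c w
swapUnmatched zero (DD ∷ w)    = DU ∷ swapUnmatched zero w
swapUnmatched (suc c) (DD ∷ w) = DD ∷ swapUnmatched c w

unmatchedCount : ∀ {n} → ℕ → Vec DStep n → ℕ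
unmatchedCount c w = countTrue (unmatchedDAux c w)

unmatchedCount-antitone : ∀ {n c c'} (w w' : Vec DStep n) → c < c' →
  swapUnmatched c w ≡ swapUnmatched c' w' → unmatchedCount c' w' ≤ unmatchedCount c w
unmatchedCount-antitone {c' = zero} _ _ () _
unmatchedCount-antitone [] [] _ _ = z≤n
unmatchedCount-antitone (DH ∷ w) (DH ∷ w') lt e = unmatchedCount-antitone w w' lt (∷-injectiveʳ e)
unmatchedCount-antitone (DU ∷ w) (DU ∷ w') lt e = unmatchedCount-antitone w w' (s≤s lt) (∷-injectiveʳ e)
unmatchedCount-antitone {c = zero} {suc _} (DD ∷ w) (DU ∷ w') _ e =
  m≤n⇒m≤1+n (unmatchedCount-antitone w w' z<s (∷-injectiveʳ e))
unmatchedCount-antitone {c = suc _} {suc _} (DD ∷ w) (DD ∷ w') (s≤s lt) e =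
  unmatchedCount-antitone w w' lt (∷-injectiveʳ e)
unmatchedCount-antitone {c' = suc _} (DH ∷ w) (DU ∷ w') _ ()
unmatchedCount-antitone {c' = suc _} (DH ∷ w) (DD ∷ w') _ ()
unmatchedCount-antitone {c' = suc _} (DU ∷ w) (DH ∷ w') _ ()
unmatchedCount-antitone {c' = suc _} (DU ∷ w) (DD ∷ w') _ ()
unmatchedCount-antitone {c = zero} {suc _} (DD ∷ w) (DH ∷ w') _ ()
unmatchedCount-antitone {c = zero} {suc _} (DD ∷ w) (DD ∷ w') _ ()
unmatchedCount-antitone {c = suc _} {suc _} (DD ∷ w) (DH ∷ w') _ ()
unmatchedCount-antitone {c = suc _} {suc _} (DD ∷ w) (DU ∷ w') _ ()

-- The only ambiguity is an image DU read as a DD unmatched at counter 0 or as a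
-- genuine DU; the first reading leaves strictly more unmatched D steps.
swapUnmatched-injective : ∀ {n} c (w w' : Vec DStep n) →
  swapUnmatched c w ≡ swapUnmatched c w' → unmatchedCount c w ≡ unmatchedCount c w' → w ≡ w'
swapUnmatched-injective c [] [] _ _ = refl
swapUnmatched-injective c (DH ∷ w) (DH ∷ w') e k≡k' =
  cong (DH ∷_) (swapUnmatched-injective c w w' (∷-injectiveʳ e) k≡k')
swapUnmatched-injective c (DU ∷ w) (DU ∷ w') e k≡k' =
  cong (DU ∷_) (swapUnmatched-injective (suc c) w w' (∷-injectiveʳ e) k≡k')
swapUnmatched-injective zero (DD ∷ w) (DD ∷ w') e k≡k' =
  cong (DD ∷_) (swapUnmatched-injective zero w w' (∷-injectiveʳ e) (cong pred k≡k'))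
swapUnmatched-injective (suc c) (DD ∷ w) (DD ∷ w') e k≡k' =
  cong (DD ∷_) (swapUnmatched-injective c w w' (∷-injectiveʳ e) k≡k')
swapUnmatched-injective zero (DD ∷ w) (DU ∷ w') e k≡k' =
  ⊥-elim (n≮n _ (subst (_≤ unmatchedCount zero w) (sym k≡k')
    (unmatchedCount-antitone w w' z<s (∷-injectiveʳ e))))
swapUnmatched-injective zero (DU ∷ w) (DD ∷ w') e k≡k' =
  ⊥-elim (n≮n _ (subst (_≤ unmatchedCount zero w') k≡k'
    (unmatchedCount-antitone w' w z<s (sym (∷-injectiveʳ e)))))
swapUnmatched-injective c (DH ∷ w) (DU ∷ w') () _
swapUnmatched-injective c (DU ∷ w) (DH ∷ w') () _
swapUnmatched-injective zero (DH ∷ w) (DD ∷ w') () _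
swapUnmatched-injective zero (DD ∷ w) (DH ∷ w') () _
swapUnmatched-injective (suc c) (DH ∷ w) (DD ∷ w') () _
swapUnmatched-injective (suc c) (DD ∷ w) (DH ∷ w') () _
swapUnmatched-injective (suc c) (DU ∷ w) (DD ∷ w') () _
swapUnmatched-injective (suc c) (DD ∷ w) (DU ∷ w') () _

flipAt-involutive : ∀ {n} (χ : Vec Bool n) (p : Path n) → flipAt χ (flipAt χ p) ≡ p
flipAt-involutive []           []      = refl
flipAt-involutive (false ∷ χ) (s ∷ p) = cong (s ∷_) (flipAt-involutive χ p)
flipAt-involutive (true ∷ χ)  (U ∷ p) = cong (U ∷_) (flipAt-involutive χ p)
flipAt-involutive (true ∷ χ)  (D ∷ p) = cong (D ∷_) (flipAt-involutive χ p)

flipAt-injective : ∀ {n} {χ χ' : Vec Bool n} {p p' : Path n} →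
  χ ≡ χ' → flipAt χ p ≡ flipAt χ' p' → p ≡ p'
flipAt-injective {χ = χ} {p = p} {p'} refl e = begin
  p                        ≡⟨ sym (flipAt-involutive χ p) ⟩
  flipAt χ (flipAt χ p)    ≡⟨ cong (flipAt χ) e ⟩
  flipAt χ (flipAt χ p')   ≡⟨ flipAt-involutive χ p' ⟩
  p'                       ∎
  where open ≡-Reasoning

unmatchedSet : ∀ {n} → ℕ → Path n → Path n → Vec Bool n
unmatchedSet c p q = unmatchedDAux c (disagree p q)

disagree-flipUnmatched : ∀ {n} c (p q : Path n) →
  disagree (flipAt (unmatchedSet c p q) p) (flipAt (unmatchedSet c p q) q)
    ≡ swapUnmatched c (disagree p q)
disagree-flipUnmatched c       []      []      = refl
disagree-flipUnmatched c       (U ∷ p) (U ∷ q) = cong (DH ∷_) (disagree-flipUnmatched c p q)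
disagree-flipUnmatched c       (D ∷ p) (D ∷ q) = cong (DH ∷_) (disagree-flipUnmatched c p q)
disagree-flipUnmatched c       (U ∷ p) (D ∷ q) = cong (DU ∷_) (disagree-flipUnmatched (suc c) p q)
disagree-flipUnmatched zero    (D ∷ p) (U ∷ q) = cong (DU ∷_) (disagree-flipUnmatched zero p q)
disagree-flipUnmatched (suc c) (D ∷ p) (U ∷ q) = cong (DD ∷_) (disagree-flipUnmatched c p q)

flipUnmatched-injective : ∀ {n} c (p q p' q' : Path n) →
  let χ = unmatchedSet c p q ; χ' = unmatchedSet c p' q' in
  flipAt χ p ≡ flipAt χ' p' → flipAt χ q ≡ flipAt χ' q' → countTrue χ ≡ countTrue χ' →
  p ≡ p' × q ≡ q'
flipUnmatched-injective c p q p' q' ep eq k≡k' =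
  flipAt-injective χ≡χ' ep , flipAt-injective χ≡χ' eq
  where
  w≡w' : disagree p q ≡ disagree p' q'
  w≡w' = swapUnmatched-injective c _ _
    (trans (sym (disagree-flipUnmatched c p q))
      (trans (cong₂ disagree ep eq) (disagree-flipUnmatched c p' q')))
    k≡k'
  χ≡χ' : unmatchedSet c p q ≡ unmatchedSet c p' q'
  χ≡χ' = cong (unmatchedDAux c) w≡w'

prependStep : ∀ v b {a K : ℤ} → a ≡ b ℤ.+ K → v ℤ.+ a ≡ (v ℤ.+ b) ℤ.+ K
prependStep v b {K = K} e = trans (cong (λ x → v ℤ.+ x) e) (sym (ℤP.+-assoc v b K))

height-flipUnmatched : ∀ {n} c (p q : Path n) → let k = countTrue (unmatchedSet c p q) in
  h (flipAt (unmatchedSet c p q) p) ≡ h p ℤ.+ (+ k ℤ.+ + k)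
height-flipUnmatched c       []      []      = refl
height-flipUnmatched c       (U ∷ p) (U ∷ q) = prependStep (+ 1) (h p) (height-flipUnmatched c p q)
height-flipUnmatched c       (U ∷ p) (D ∷ q) = prependStep (+ 1) (h p) (height-flipUnmatched (suc c) p q)
height-flipUnmatched c       (D ∷ p) (D ∷ q) = prependStep (- + 1) (h p) (height-flipUnmatched c p q)
height-flipUnmatched (suc c) (D ∷ p) (U ∷ q) = prependStep (- + 1) (h p) (height-flipUnmatched c p q)
height-flipUnmatched zero    (D ∷ p) (U ∷ q) =
  trans (cong (λ x → + 1 ℤ.+ x) (height-flipUnmatched zero p q)) (flipped (h p) (+ k))
  where
  k = countTrue (unmatchedSet zero p q)
  flipped : ∀ x y → + 1 ℤ.+ (x ℤ.+ (y ℤ.+ y)) ≡ (- + 1 ℤ.+ x) ℤ.+ ((+ 1 ℤ.+ y) ℤ.+ (+ 1 ℤ.+ y))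
  flipped = solve-∀

i+[k+k]≡i+[k'+k']⇒k≡k' : ∀ (i : ℤ) {k k'} → i ℤ.+ (+ k ℤ.+ + k) ≡ i ℤ.+ (+ k' ℤ.+ + k') → k ≡ k'
i+[k+k]≡i+[k'+k']⇒k≡k' i {k} {k'} e = begin
  k                ≡⟨ n≡⌊n+n/2⌋ k ⟩
  ⌊ k + k /2⌋      ≡⟨ cong ⌊_/2⌋ (ℤP.+-injective (∙-cancelˡ i _ _ e)) ⟩
  ⌊ k' + k' /2⌋    ≡⟨ sym (n≡⌊n+n/2⌋ k') ⟩
  k'               ∎
  where open ≡-Reasoning

if-flipStep-≢ : ∀ b → (if b then flipStep U else U) ≢ (if b then flipStep D else D)
if-flipStep-≢ true  ()
if-flipStep-≢ false ()

-- c is the height of the original path before the current step; flipNegAux c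
-- alone is not injective (U is the image of both U and D when c ∈ {-1, 0}),
-- which is why the final heights are needed.
flipNegAux-injective : ∀ {n} (c c' : ℤ) (q q' : Path n) → flipNegAux c q ≡ flipNegAux c' q' →
  c ℤ.+ h q ≡ c' ℤ.+ h q' → c ≡ c' × q ≡ q'
flipNegAux-injective c c' [] [] _ e =
  trans (sym (ℤP.+-identityʳ c)) (trans e (ℤP.+-identityʳ c')) , refl
flipNegAux-injective c c' (s ∷ q) (s' ∷ q') e he
  with flipNegAux-injective (c ℤ.+ stepVal s) (c' ℤ.+ stepVal s') q q' (∷-injectiveʳ e)
         (trans (ℤP.+-assoc c (stepVal s) (h q)) (trans he (sym (ℤP.+-assoc c' (stepVal s') (h q')))))
... | c+s≡c'+s' , refl = heads s s' (∷-injectiveˡ e) c+s≡c'+s'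
  where
  heads : ∀ s s' →
    (if ⌊ c ℤ.+ stepVal s <? + 0 ⌋ then flipStep s else s)
      ≡ (if ⌊ c' ℤ.+ stepVal s' <? + 0 ⌋ then flipStep s' else s') →
    c ℤ.+ stepVal s ≡ c' ℤ.+ stepVal s' → c ≡ c' × s ∷ q ≡ s' ∷ q
  heads U U _ e = ∙-cancelʳ (+ 1) c c' e , refl
  heads D D _ e = ∙-cancelʳ (- + 1) c c' e , refl
  heads U D out≡ e =
    ⊥-elim (if-flipStep-≢ _ (subst (λ x → (if ⌊ x <? + 0 ⌋ then D else U) ≡ _) e out≡))
  heads D U out≡ e =
    ⊥-elim (if-flipStep-≢ _ (sym (subst (λ x → (if ⌊ x <? + 0 ⌋ then U else D) ≡ _) e out≡)))

flipNeg-injective : ∀ {n} (q q' : Path n) → flipNeg q ≡ flipNeg q' → h q ≡ h q' → q ≡ q'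
flipNeg-injective q q' e hq≡hq' =
  proj₂ (flipNegAux-injective (+ 0) (+ 0) q q' e (cong (λ x → + 0 ℤ.+ x) hq≡hq'))

lemma5p3 : (n i j : ℕ) → j ≤ i → i + j ≤ n → (i + j) % 2 ≡ n % 2 →
    (P Q P₂ Q₂ : Path n) → inM n i j P Q → inM n i j P₂ Q₂ →
    φ P Q ≡ φ P₂ Q₂ → (P ≡ P₂) × (Q ≡ Q₂)
lemma5p3 n i j _ _ _ P Q P₂ Q₂ (_ , _ , hP , hQ) (_ , _ , hP₂ , hQ₂) φ≡ =
  let P≡P₂ , Q′≡Q′₂ = flipUnmatched-injective 0 P Q′ P₂ Q′₂ P̃≡P̃₂ (cong proj₂ φ≡) k≡k₂
  in P≡P₂ , flipNeg-injective Q Q₂ Q′≡Q′₂ (trans hQ (sym hQ₂))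
  where
  Q′ = flipNeg Q
  Q′₂ = flipNeg Q₂
  k = countTrue (unmatchedSet 0 P Q′)
  k₂ = countTrue (unmatchedSet 0 P₂ Q′₂)
  P̃≡P̃₂ = cong proj₁ φ≡
  open ≡-Reasoning
  k≡k₂ : k ≡ k₂
  k≡k₂ = i+[k+k]≡i+[k'+k']⇒k≡k' (h P) (begin
    h P ℤ.+ (+ k ℤ.+ + k)       ≡⟨ height-flipUnmatched 0 P Q′ ⟨
    h (proj₁ (φ P Q))           ≡⟨ cong h P̃≡P̃₂ ⟩
    h (proj₁ (φ P₂ Q₂))         ≡⟨ height-flipUnmatched 0 P₂ Q′₂ ⟩
    h P₂ ℤ.+ (+ k₂ ℤ.+ + k₂)    ≡⟨ cong (λ x → x ℤ.+ (+ k₂ ℤ.+ + k₂)) (trans hP₂ (sym hP)) ⟩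
    h P ℤ.+ (+ k₂ ℤ.+ + k₂)     ∎)
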